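{- Let $u\in\mathfrak S_n$ and let $\mathrm{Rothe}(u)=\{(i,j): u_i<j,\ u^{ -1}(j)>i\}$. To a box of $\mathrm{Rothe}(u)$ lying in row $i$ which is the $h$-th box of $\mathrm{Rothe}(u)$ in row $i$ counted from the right, associate the simple transposition $s_{i+h-1}$. Let $s_{i_1},s_{i_2},\dots,s_{i_m}$ be the transpositions associated to the boxes of $\mathrm{Rothe}(u)$, listed row by row from the bottom row to the top row, and within each row from right to left, and set $x=s_{i_1}s_{i_2}\cdots s_{i_m}$. Then $ux=w_0$, and the expression $s_{i_1}\cdots s_{i_m}$ for $x$ is reduced.
   Context: Permutations in $\mathfrak S_n$ are in one-line notation and multiplied as functions, $(uv)(i)=u(v(i))$; $s_i=(i\ i{+}1)$ and $w_0=n(n-1)\cdots 21$ is the longest permutation. Boxes $(i,j)$ are indexed by row $i$ (from the top) and column $j$ (from the left) of an $n\times n$ array. -}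

module Defs where

open import Data.Nat as ℕ using (ℕ; zero; suc; _+_; _∸_)
open import Data.Nat.Properties as ℕP using (≤-trans; n≤1+n)
open import Data.Fin as F using (Fin; toℕ; fromℕ<; opposite)
open import Data.Fin.Properties as FP using ()
open import Data.Fin.Permutation using (Permutation′; _⟨$⟩ʳ_; _⟨$⟩ˡ_; transpose)
open import Data.List using (List; []; _∷_; length; filter; map; reverse; concatMap; allFin)
open import Data.List.Relation.Unary.All using (All)
open import Data.Product using (_×_)
open import Relation.Nullary using (yes; no; _×-dec_)
open import Relation.Binary.PropositionalEquality using (_≡_)
open import Function using (id; _∘_)

-- Conventions: rows/columns/values of Fin n are 0-indexed (Fin value a
-- stands for a+1); simple transposition letters are natural numbers k
-- with the paper's 1-indexed meaning: s_k = (k k+1), valid for 1 ≤ k < n.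

-- s_k acting on Fin n (0-indexed positions k-1 and k); identity if k is
-- not a valid letter (k = 0 or k ≥ n).
s : ∀ {n} → ℕ → Fin n → Fin n
s {n} zero = id
s {n} (suc k) with suc k ℕ.<? n
... | yes k+1<n = transpose (fromℕ< (≤-trans (n≤1+n (suc k)) k+1<n)) (fromℕ< k+1<n) ⟨$⟩ʳ_
... | no _ = id

ValidLetter : ℕ → ℕ → Set
ValidLetter n k = (1 ℕ.≤ k) × (k ℕ.< n)

wordFn : ∀ {n} → List ℕ → Fin n → Fin n
wordFn [] = id
wordFn (k ∷ w) = s k ∘ wordFn w

Reduced : (n : ℕ) → List ℕ → Set
Reduced n w = All (ValidLetter n) w
  × (∀ (w' : List ℕ) → All (ValidLetter n) w'
       → (∀ (j : Fin n) → wordFn w' j ≡ wordFn w j)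
       → length w ℕ.≤ length w')

w₀ : ∀ {n} → Fin n → Fin n
w₀ = opposite

rotheDec : ∀ {n} (u : Permutation′ n) (r c : Fin n) → _
rotheDec u r c = ((u ⟨$⟩ʳ r) FP.<? c) ×-dec (r FP.<? (u ⟨$⟩ˡ c))

rowBoxes : ∀ {n} (u : Permutation′ n) (r : Fin n) → List (Fin n)
rowBoxes {n} u r = filter (rotheDec u r) (reverse (allFin n))

hIndex : ∀ {n} (u : Permutation′ n) (r c : Fin n) → ℕ
hIndex u r c = length (filter (λ c' → c FP.≤? c') (rowBoxes u r))

-- letter associated to box (r , c): s_{i+h-1} with i = toℕ r + 1 the
-- 1-indexed row, i.e. the letter toℕ r + h
boxLetter : ∀ {n} (u : Permutation′ n) (r c : Fin n) → ℕ
boxLetter u r c = toℕ r + hIndex u r c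

rowWord : ∀ {n} (u : Permutation′ n) (r : Fin n) → List ℕ
rowWord u r = map (boxLetter u r) (rowBoxes u r)

rotheWord : ∀ {n} (u : Permutation′ n) → List ℕ
rotheWord {n} u = concatMap (rowWord u) (reverse (allFin n))

{-# OPTIONS --safe #-}
module Submission where

-- Write permutations of [n] in one-line notation as lists.  Multiplying on the right by s_k
-- swaps the entries in positions k and k+1, so it changes the number of inversions by at
-- most one.  Let π_k be u(1) ⋯ u(k) followed by the remaining values in decreasing order,
-- so that π_n = u and π_0 = w₀.  In π_i the values after u(i) that exceed it are exactly
-- the columns of the boxes of row i of Rothe(u), and they come first; moving u(i) to the
-- right past these m values is the word s_i s_{i+1} ⋯ s_{i+m-1} of row i, each letter
-- swapping an ascent, and it produces π_{i-1}.  Reading the rows from the bottom therefore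
-- leads from u to w₀ and raises the number of inversions by one at every letter, so u x = w₀
-- and no shorter word has this property.

open import Defs
open import Data.Nat as ℕ using (ℕ; zero; suc; _+_; _≤_; _<_; z≤n; s≤s; s<s; s<s⁻¹)
open import Data.Nat.Properties
  using (n≤1+n; n<1+n; ≤-refl; ≤-reflexive; <⇒≤; <⇒≱; ≤∧≢⇒<; <-trans; m≤m+n; +-comm; +-suc;
         +-identityʳ; +-monoʳ-≤; +-cancelʳ-≤; m≤n⇒m⊓n≡m; ∸-monoʳ-<; module ≤-Reasoning)
open import Data.Nat.Tactic.RingSolver using (solve-∀)
open import Data.Fin as F using (Fin; toℕ; fromℕ<; fromℕ; inject₁; opposite)
import Data.Fin.Properties as FP
open import Data.Fin.Permutation using (Permutation′; _⟨$⟩ʳ_; _⟨$⟩ˡ_; inverseˡ; inverseʳ; lift₀-transpose)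
import Data.Fin.Permutation.Components as PC
open import Data.List
  using (List; []; _∷_; [_]; _++_; _∷ʳ_; length; map; filter; reverse; tabulate; take; allFin; concatMap)
open import Data.List.Properties
  using (tabulate-cong; length-tabulate; take-suc-tabulate; take-all; length-take; reverse-++; ++-assoc;
         ++-identityʳ; ∷-injective; map-id; map-∘; map-cong-local;
         filter-accept; filter-reject; filter-all; filter-none; filter-++)
open import Data.List.Relation.Unary.All as All using (All; []; _∷_)
import Data.List.Relation.Unary.All.Properties as All
open import Data.List.Relation.Unary.AllPairs using (AllPairs; []; _∷_)
import Data.List.Relation.Unary.AllPairs.Properties as AllPairs
open import Data.List.Relation.Unary.Any using (here; there)
import Data.List.Relation.Unary.Any.Properties as Any
open import Data.List.Membership.Propositional using (_∈_)
open import Data.List.Membership.Propositional.Properties using (∈-allFin)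
open import Data.List.Relation.Binary.Permutation.Propositional using (_↭_; refl; prep; swap)
open import Data.List.Relation.Binary.Permutation.Propositional.Properties using (↭-length; filter-↭)
open import Data.Product using (_×_; _,_; proj₁; proj₂)
open import Function using (_∘_; id; flip)
open import Level using (Level)
open import Relation.Binary as B using (Rel; Asymmetric)
open import Relation.Binary.PropositionalEquality
  using (_≡_; _≢_; _≗_; refl; sym; trans; cong; cong₂; subst; subst₂; module ≡-Reasoning)
open import Relation.Nullary using (Dec; yes; no; ¬_; _×-dec_)
open import Relation.Nullary.Negation using (contradiction)
open import Relation.Unary using (Pred; Decidable)

private
  variable
    a p q ℓ : Level
    A : Set a
    P : Set p

module _ {A : Set a} where

  tabulate-∷ʳ : ∀ {m} (f : Fin (suc m) → A) → tabulate f ≡ tabulate (f ∘ inject₁) ∷ʳ f (fromℕ m)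
  tabulate-∷ʳ {m = zero} f = refl
  tabulate-∷ʳ {m = suc m} f = cong (f F.zero ∷_) (tabulate-∷ʳ (f ∘ F.suc))

  reverse-tabulate : ∀ {m} (f : Fin m → A) → reverse (tabulate f) ≡ tabulate (f ∘ opposite)
  reverse-tabulate {m = zero} f = refl
  reverse-tabulate {m = suc m} f = begin
    reverse (tabulate f)                            ≡⟨ cong reverse (tabulate-∷ʳ f) ⟩
    reverse (tabulate (f ∘ inject₁) ∷ʳ f (fromℕ m)) ≡⟨ reverse-++ (tabulate (f ∘ inject₁)) [ f (fromℕ m) ] ⟩
    f (fromℕ m) ∷ reverse (tabulate (f ∘ inject₁))  ≡⟨ cong (f (fromℕ m) ∷_) (reverse-tabulate (f ∘ inject₁)) ⟩
    tabulate (f ∘ opposite)                         ∎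
    where open ≡-Reasoning

  tabulate-injective : ∀ {m} {f g : Fin m → A} → tabulate f ≡ tabulate g → f ≗ g
  tabulate-injective {m = suc m} eq F.zero = proj₁ (∷-injective eq)
  tabulate-injective {m = suc m} {f} {g} eq (F.suc i) =
    tabulate-injective {f = f ∘ F.suc} {g = g ∘ F.suc} (proj₂ (∷-injective eq)) i

  tabulate⁺-mono : ∀ {R : Rel A ℓ} {m} {f : Fin m → A} →
                   (∀ {i j} → i F.< j → R (f i) (f j)) → AllPairs R (tabulate f)
  tabulate⁺-mono {m = zero} f-mono = []
  tabulate⁺-mono {m = suc m} f-mono =
    All.tabulate⁺ (λ j → f-mono (s≤s z≤n)) ∷ tabulate⁺-mono (λ i<j → f-mono (s≤s i<j))

  module _ {P : Pred A p} {Q : Pred A q} (P? : Decidable P) (Q? : Decidable Q) where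

    filter-×-dec : ∀ xs → filter (λ x → P? x ×-dec Q? x) xs ≡ filter Q? (filter P? xs)
    filter-×-dec [] = refl
    filter-×-dec (x ∷ xs) with P? x
    ... | no _ = filter-×-dec xs
    ... | yes _ with Q? x
    ...   | yes _ = cong (x ∷_) (filter-×-dec xs)
    ...   | no _  = filter-×-dec xs

    filter-cong-All : ∀ {xs} → All (λ x → (P x → Q x) × (Q x → P x)) xs → filter P? xs ≡ filter Q? xs
    filter-cong-All [] = refl
    filter-cong-All {x ∷ _} ((P⇒Q , Q⇒P) ∷ rest) with P? x | Q? x
    ... | yes _   | yes _   = cong (x ∷_) (filter-cong-All rest)
    ... | yes px  | no ¬qx  = contradiction (P⇒Q px) ¬qx
    ... | no ¬px  | yes qx  = contradiction (Q⇒P qx) ¬px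
    ... | no _    | no _    = filter-cong-All rest

  module _ {_≺_ : Rel A ℓ} (_≺?_ : B.Decidable _≺_) (≺-asym : Asymmetric _≺_) where

    split-descending : ∀ {x xs} → AllPairs (flip _≺_) xs → x ∈ xs →
                       xs ≡ filter (x ≺?_) xs ++ x ∷ filter (_≺? x) xs
    split-descending {x} {_ ∷ xs} (below ∷ _) (here refl) = sym (cong₂ (λ ys zs → ys ++ x ∷ zs)
      (trans (filter-reject (x ≺?_) x⊀x) (filter-none (x ≺?_) (All.map ≺-asym below)))
      (trans (filter-reject (_≺? x) x⊀x) (filter-all (_≺? x) below)))
      where x⊀x = λ x≺x → ≺-asym x≺x x≺x
    split-descending {x} {y ∷ xs} (above ∷ desc) (there x∈xs) = begin
      y ∷ xs                                              ≡⟨ cong (y ∷_) (split-descending desc x∈xs) ⟩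
      y ∷ (filter (x ≺?_) xs ++ x ∷ filter (_≺? x) xs)    ≡⟨ cong₂ (λ ys zs → ys ++ x ∷ zs)
                                                              (filter-accept (x ≺?_) x≺y)
                                                              (filter-reject (_≺? x) (≺-asym x≺y)) ⟨
      filter (x ≺?_) (y ∷ xs) ++ x ∷ filter (_≺? x) (y ∷ xs) ∎
      where open ≡-Reasoning
            x≺y = All.lookup above x∈xs

-- Right multiplication by s_k in one-line notation (positions 1-indexed; the identity when
-- s_k is not a letter of S_(length xs), as for s in Defs).
swapAt : ℕ → List A → List A
swapAt zero          xs           = xs
swapAt (suc zero)    (x ∷ y ∷ xs) = y ∷ x ∷ xs
swapAt (suc zero)    xs           = xs
swapAt (suc (suc k)) []           = []
swapAt (suc (suc k)) (x ∷ xs)     = x ∷ swapAt (suc k) xs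

applyWord : List A → List ℕ → List A
applyWord xs []      = xs
applyWord xs (k ∷ w) = applyWord (swapAt k xs) w

swapAt-↭ : ∀ k (xs : List A) → swapAt k xs ↭ xs
swapAt-↭ zero          xs           = refl
swapAt-↭ (suc zero)    []           = refl
swapAt-↭ (suc zero)    (x ∷ [])     = refl
swapAt-↭ (suc zero)    (x ∷ y ∷ xs) = swap y x refl
swapAt-↭ (suc (suc k)) []           = refl
swapAt-↭ (suc (suc k)) (x ∷ xs)     = prep x (swapAt-↭ (suc k) xs)

-- s_{k+1} s_{k+2} ⋯ s_{k+m}, which moves the entry in position k+1 to position k+m+1.
bubbleWord : ℕ → ℕ → List ℕ
bubbleWord k zero    = []
bubbleWord k (suc m) = suc k ∷ bubbleWord (suc k) m

map-+-bubbleWord : ∀ j k m → map (j +_) (bubbleWord k m) ≡ bubbleWord (j + k) m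
map-+-bubbleWord j k zero    = refl
map-+-bubbleWord j k (suc m) = cong₂ _∷_ (+-suc j k)
  (trans (map-+-bubbleWord j (suc k) m) (cong (λ i → bubbleWord i m) (+-suc j k)))

indicator : Dec P → ℕ
indicator (yes _) = 1
indicator (no _)  = 0

indicator≤1 : (d : Dec P) → indicator d ≤ 1
indicator≤1 (yes _) = ≤-refl
indicator≤1 (no _)  = z≤n

indicator-yes : P → (d : Dec P) → indicator d ≡ 1
indicator-yes _ (yes _)  = refl
indicator-yes p (no ¬p)  = contradiction p ¬p

indicator-no : ¬ P → (d : Dec P) → indicator d ≡ 0
indicator-no ¬p (yes p) = contradiction p ¬p
indicator-no _  (no _)  = refl

module Inversions {A : Set a} {_≺_ : Rel A ℓ} (_≺?_ : B.Decidable _≺_) (≺-asym : Asymmetric _≺_) where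

  countBelow : A → List A → ℕ
  countBelow x = length ∘ filter (_≺? x)

  inversions : List A → ℕ
  inversions []       = 0
  inversions (x ∷ xs) = countBelow x xs + inversions xs

  countBelow-∷ : ∀ x y ys → countBelow x (y ∷ ys) ≡ indicator (y ≺? x) + countBelow x ys
  countBelow-∷ x y ys with y ≺? x
  ... | yes _ = refl
  ... | no _  = refl

  countBelow-↭ : ∀ x {xs ys} → xs ↭ ys → countBelow x xs ≡ countBelow x ys
  countBelow-↭ x = ↭-length ∘ filter-↭ (_≺? x)

  inversions-swap : ∀ x y zs →
    inversions (y ∷ x ∷ zs) + indicator (y ≺? x) ≡ inversions (x ∷ y ∷ zs) + indicator (x ≺? y)
  inversions-swap x y zs = begin
    countBelow y (x ∷ zs) + (countBelow x zs + inversions zs) + indicator (y ≺? x)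
      ≡⟨ cong (λ c → c + (countBelow x zs + inversions zs) + indicator (y ≺? x)) (countBelow-∷ y x zs) ⟩
    indicator (x ≺? y) + countBelow y zs + (countBelow x zs + inversions zs) + indicator (y ≺? x)
      ≡⟨ rearrange (indicator (x ≺? y)) (indicator (y ≺? x)) (countBelow y zs) (countBelow x zs) _ ⟩
    indicator (y ≺? x) + countBelow x zs + (countBelow y zs + inversions zs) + indicator (x ≺? y)
      ≡⟨ cong (λ c → c + (countBelow y zs + inversions zs) + indicator (x ≺? y)) (countBelow-∷ x y zs) ⟨
    countBelow x (y ∷ zs) + (countBelow y zs + inversions zs) + indicator (x ≺? y) ∎
    where
      open ≡-Reasoning
      rearrange : ∀ p q b c i → p + b + (c + i) + q ≡ q + c + (b + i) + p
      rearrange = solve-∀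

  inversions-swapAt-≤ : ∀ k xs → inversions (swapAt k xs) ≤ suc (inversions xs)
  inversions-swapAt-≤ zero          xs           = n≤1+n _
  inversions-swapAt-≤ (suc zero)    []           = n≤1+n _
  inversions-swapAt-≤ (suc zero)    (x ∷ [])     = n≤1+n _
  inversions-swapAt-≤ (suc zero)    (x ∷ y ∷ zs) = begin
    inversions (y ∷ x ∷ zs)                         ≤⟨ m≤m+n _ (indicator (y ≺? x)) ⟩
    inversions (y ∷ x ∷ zs) + indicator (y ≺? x)    ≡⟨ inversions-swap x y zs ⟩
    inversions (x ∷ y ∷ zs) + indicator (x ≺? y)    ≤⟨ +-monoʳ-≤ _ (indicator≤1 (x ≺? y)) ⟩
    inversions (x ∷ y ∷ zs) + 1                     ≡⟨ +-comm _ 1 ⟩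
    suc (inversions (x ∷ y ∷ zs))                   ∎
    where open ≤-Reasoning
  inversions-swapAt-≤ (suc (suc k)) []           = n≤1+n _
  inversions-swapAt-≤ (suc (suc k)) (x ∷ xs)     = begin
    countBelow x (swapAt (suc k) xs) + inversions (swapAt (suc k) xs)
      ≡⟨ cong (_+ inversions (swapAt (suc k) xs)) (countBelow-↭ x (swapAt-↭ (suc k) xs)) ⟩
    countBelow x xs + inversions (swapAt (suc k) xs)
      ≤⟨ +-monoʳ-≤ (countBelow x xs) (inversions-swapAt-≤ (suc k) xs) ⟩
    countBelow x xs + suc (inversions xs)
      ≡⟨ +-suc (countBelow x xs) (inversions xs) ⟩
    suc (inversions (x ∷ xs)) ∎
    where open ≤-Reasoning

  inversions-ascent : ∀ {x y} zs → x ≺ y → inversions (y ∷ x ∷ zs) ≡ suc (inversions (x ∷ y ∷ zs))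
  inversions-ascent {x} {y} zs x≺y = begin
    inversions (y ∷ x ∷ zs)
      ≡⟨ +-identityʳ _ ⟨
    inversions (y ∷ x ∷ zs) + 0
      ≡⟨ cong (inversions (y ∷ x ∷ zs) +_) (indicator-no (≺-asym x≺y) (y ≺? x)) ⟨
    inversions (y ∷ x ∷ zs) + indicator (y ≺? x)
      ≡⟨ inversions-swap x y zs ⟩
    inversions (x ∷ y ∷ zs) + indicator (x ≺? y)
      ≡⟨ cong (inversions (x ∷ y ∷ zs) +_) (indicator-yes x≺y (x ≺? y)) ⟩
    inversions (x ∷ y ∷ zs) + 1
      ≡⟨ +-comm _ 1 ⟩
    suc (inversions (x ∷ y ∷ zs)) ∎
    where open ≡-Reasoning

  inversions-applyWord-≤ : ∀ xs w → inversions (applyWord xs w) ≤ length w + inversions xs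
  inversions-applyWord-≤ xs []      = ≤-refl
  inversions-applyWord-≤ xs (k ∷ w) = begin
    inversions (applyWord (swapAt k xs) w)   ≤⟨ inversions-applyWord-≤ (swapAt k xs) w ⟩
    length w + inversions (swapAt k xs)      ≤⟨ +-monoʳ-≤ (length w) (inversions-swapAt-≤ k xs) ⟩
    length w + suc (inversions xs)           ≡⟨ +-suc (length w) (inversions xs) ⟩
    length (k ∷ w) + inversions xs           ∎
    where open ≤-Reasoning

  -- Saturated chains of the right weak order, labelled by their words.
  data Climb : List A → List ℕ → List A → Set a where
    done : ∀ {xs} → Climb xs [] xs
    step : ∀ {xs} {k : ℕ} {w ys} → suc k < length xs →
           inversions (swapAt (suc k) xs) ≡ suc (inversions xs) →
           Climb (swapAt (suc k) xs) w ys → Climb xs (suc k ∷ w) ys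

  Climb-cast : ∀ {xs xs′ w w′ ys ys′} → xs ≡ xs′ → w ≡ w′ → ys ≡ ys′ → Climb xs w ys → Climb xs′ w′ ys′
  Climb-cast refl refl refl c = c

  _++ᶜ_ : ∀ {xs v ys w zs} → Climb xs v ys → Climb ys w zs → Climb xs (v ++ w) zs
  done              ++ᶜ d = d
  step bound up c   ++ᶜ d = step bound up (c ++ᶜ d)

  climb-applyWord : ∀ {xs w ys} → Climb xs w ys → applyWord xs w ≡ ys
  climb-applyWord done           = refl
  climb-applyWord (step _ _ c)   = climb-applyWord c

  climb-inversions : ∀ {xs w ys} → Climb xs w ys → inversions ys ≡ length w + inversions xs
  climb-inversions done = refl
  climb-inversions {xs} {_ ∷ w} (step _ up c) =
    trans (climb-inversions c) (trans (cong (length w +_) up) (+-suc (length w) (inversions xs)))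

  climb-validLetters : ∀ {xs w ys} → Climb xs w ys → All (ValidLetter (length xs)) w
  climb-validLetters done = []
  climb-validLetters {xs} (step {k = k} {w} bound _ c) =
    (s≤s z≤n , bound) ∷
    subst (λ m → All (ValidLetter m) w) (↭-length (swapAt-↭ (suc k) xs)) (climb-validLetters c)

  climb-shortest : ∀ {xs w ys} w′ → Climb xs w ys → applyWord xs w′ ≡ ys → length w ≤ length w′
  climb-shortest {xs} {w} {ys} w′ c w′-reaches = +-cancelʳ-≤ (inversions xs) (length w) (length w′) (begin
    length w + inversions xs        ≡⟨ climb-inversions c ⟨
    inversions ys                   ≡⟨ cong inversions w′-reaches ⟨
    inversions (applyWord xs w′)    ≤⟨ inversions-applyWord-≤ xs w′ ⟩
    length w′ + inversions xs       ∎)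
    where open ≤-Reasoning

  climb-∷ : ∀ {xs w ys} x → Climb xs w ys → Climb (x ∷ xs) (map suc w) (x ∷ ys)
  climb-∷ x done = done
  climb-∷ x (step {xs} {k} bound up c) = step (s≤s bound) (begin
    countBelow x (swapAt (suc k) xs) + inversions (swapAt (suc k) xs)
      ≡⟨ cong₂ _+_ (countBelow-↭ x (swapAt-↭ (suc k) xs)) up ⟩
    countBelow x xs + suc (inversions xs)
      ≡⟨ +-suc (countBelow x xs) (inversions xs) ⟩
    suc (inversions (x ∷ xs)) ∎) (climb-∷ x c)
    where open ≡-Reasoning

  climb-++ˡ : ∀ {xs w ys} ps → Climb xs w ys → Climb (ps ++ xs) (map (length ps +_) w) (ps ++ ys)
  climb-++ˡ {w = w} []       c = Climb-cast refl (sym (map-id w)) refl c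
  climb-++ˡ {w = w} (p ∷ ps) c = Climb-cast refl (sym (map-∘ w)) refl (climb-∷ p (climb-++ˡ ps c))

  climb-bubble : ∀ {x ys} zs → All (x ≺_) ys → Climb (x ∷ ys ++ zs) (bubbleWord 0 (length ys)) (ys ++ x ∷ zs)
  climb-bubble zs [] = done
  climb-bubble {x} {y ∷ ys} zs (x≺y ∷ x≺ys) =
    step (s≤s (s≤s z≤n)) (inversions-ascent (ys ++ zs) x≺y)
      (Climb-cast refl (map-+-bubbleWord 1 0 (length ys)) refl (climb-∷ y (climb-bubble zs x≺ys)))

s-out-of-range : ∀ {n} k → ¬ suc k < n → s {n} (suc k) ≗ id
s-out-of-range {n} k k≮n j with suc k ℕ.<? n
... | yes k<n = contradiction k<n k≮n
... | no _    = refl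

s-in-range : ∀ {n} k (k<n : suc k < n) →
             s {n} (suc k) ≗ PC.transpose (fromℕ< (<-trans (n<1+n k) k<n)) (fromℕ< k<n)
s-in-range {n} k k<n j with suc k ℕ.<? n
... | yes _   = refl
... | no k≮n  = contradiction k<n k≮n

s-fixes-zero : ∀ {m} k → s {suc m} (suc (suc k)) F.zero ≡ F.zero
s-fixes-zero {m} k = by-range (suc k ℕ.<? m)
  where
    by-range : Dec (suc k < m) → s {suc m} (suc (suc k)) F.zero ≡ F.zero
    by-range (yes k<m) = s-in-range (suc k) (s<s k<m) F.zero
    by-range (no k≮m)  = s-out-of-range (suc k) (k≮m ∘ s<s⁻¹) F.zero

s-suc : ∀ {m} k (j : Fin m) → s {suc m} (suc (suc k)) (F.suc j) ≡ F.suc (s (suc k) j)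
s-suc {m} k j = by-range (suc k ℕ.<? m)
  where
    open ≡-Reasoning
    by-range : Dec (suc k < m) → s {suc m} (suc (suc k)) (F.suc j) ≡ F.suc (s (suc k) j)
    by-range (yes k<m) = begin
      s (suc (suc k)) (F.suc j)                   ≡⟨ s-in-range (suc k) (s<s k<m) (F.suc j) ⟩
      PC.transpose (F.suc i) (F.suc i′) (F.suc j) ≡⟨ lift₀-transpose i i′ (F.suc j) ⟩
      F.suc (PC.transpose i i′ j)                 ≡⟨ cong F.suc (s-in-range k k<m j) ⟨
      F.suc (s (suc k) j)                         ∎
      where
        i = fromℕ< (<-trans (n<1+n k) k<m)
        i′ = fromℕ< k<m
    by-range (no k≮m) =
      trans (s-out-of-range (suc k) (k≮m ∘ s<s⁻¹) (F.suc j)) (cong F.suc (sym (s-out-of-range k k≮m j)))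

tabulate-∘-s : ∀ {n} k (f : Fin n → A) → tabulate (f ∘ s k) ≡ swapAt k (tabulate f)
tabulate-∘-s                zero          f = refl
tabulate-∘-s {n = zero}     (suc zero)    f = refl
tabulate-∘-s {n = suc zero} (suc zero)    f = cong (λ j → f j ∷ []) (s-out-of-range 0 (λ { (s≤s ()) }) F.zero)
tabulate-∘-s {n = suc (suc m)} (suc zero) f = refl   -- s 1 computes to the transposition of 0F and 1F
tabulate-∘-s {n = zero}     (suc (suc k)) f = refl
tabulate-∘-s {n = suc m}    (suc (suc k)) f = cong₂ _∷_ (cong f (s-fixes-zero k)) (begin
  tabulate (f ∘ s (suc (suc k)) ∘ F.suc)   ≡⟨ tabulate-cong (cong f ∘ s-suc k) ⟩
  tabulate ((f ∘ F.suc) ∘ s (suc k))       ≡⟨ tabulate-∘-s (suc k) (f ∘ F.suc) ⟩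
  swapAt (suc k) (tabulate (f ∘ F.suc))    ∎)
  where open ≡-Reasoning

tabulate-∘-wordFn : ∀ {n} w (f : Fin n → A) → tabulate (f ∘ wordFn w) ≡ applyWord (tabulate f) w
tabulate-∘-wordFn []      f = refl
tabulate-∘-wordFn (k ∷ w) f =
  trans (tabulate-∘-wordFn w (f ∘ s k)) (cong (λ xs → applyWord xs w) (tabulate-∘-s k f))

opposite-anti : ∀ {m} {i j : Fin m} → i F.< j → opposite j F.< opposite i
opposite-anti {i = i} {j} i<j =
  subst₂ _<_ (sym (FP.opposite-prop j)) (sym (FP.opposite-prop i)) (∸-monoʳ-< (s<s i<j) (FP.toℕ<n j))

descending-reverseAllFin : ∀ {n} → AllPairs F._>_ (reverse (allFin n))
descending-reverseAllFin = subst (AllPairs F._>_) (sym (reverse-tabulate id)) (tabulate⁺-mono opposite-anti)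

descending-ranks : ∀ {n} k {cs : List (Fin n)} → AllPairs F._>_ cs →
                   map (λ c → k + length (filter (c FP.≤?_) cs)) cs ≡ bubbleWord k (length cs)
descending-ranks k [] = refl
descending-ranks k {c ∷ cs} (c>cs ∷ desc) =
  cong₂ _∷_ rank-c (trans (map-cong-local (All.map rank-below c>cs)) (descending-ranks (suc k) desc))
  where
    open ≡-Reasoning
    rank-c : k + length (filter (c FP.≤?_) (c ∷ cs)) ≡ suc k
    rank-c = begin
      k + length (filter (c FP.≤?_) (c ∷ cs))  ≡⟨ cong (λ ds → k + length ds) (filter-accept (c FP.≤?_) ≤-refl) ⟩
      k + suc (length (filter (c FP.≤?_) cs))  ≡⟨ cong (λ ds → k + suc (length ds))
                                                    (filter-none (c FP.≤?_) (All.map <⇒≱ c>cs)) ⟩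
      k + 1                                    ≡⟨ +-comm k 1 ⟩
      suc k                                    ∎
    rank-below : ∀ {d} → d F.< c →
                 k + length (filter (d FP.≤?_) (c ∷ cs)) ≡ suc k + length (filter (d FP.≤?_) cs)
    rank-below {d} d<c = trans (cong (λ ds → k + length ds) (filter-accept (d FP.≤?_) (<⇒≤ d<c))) (+-suc k _)

module Rothe {n} (u : Permutation′ n) where
  open Inversions (FP._<?_ {n} {n}) FP.<-asym

  -- partiallySorted k is π_k: the first k entries of u, then the other values in decreasing order.
  laterValues : ℕ → List (Fin n)
  laterValues k = filter (λ c → k ℕ.≤? toℕ (u ⟨$⟩ˡ c)) (reverse (allFin n))

  partiallySorted : ℕ → List (Fin n)
  partiallySorted k = take k (tabulate (u ⟨$⟩ʳ_)) ++ laterValues k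

  module _ (r : Fin n) where
    private
      uᵣ = u ⟨$⟩ʳ r
      later? = λ c → r FP.<? (u ⟨$⟩ˡ c)
      atOrLater? = λ c → toℕ r ℕ.≤? toℕ (u ⟨$⟩ˡ c)
      larger = filter (uᵣ FP.<?_) (reverse (allFin n))
      smaller = filter (FP._<? uᵣ) (reverse (allFin n))
      prefix = take (toℕ r) (tabulate (u ⟨$⟩ʳ_))

    smallerLaterValues : List (Fin n)
    smallerLaterValues = filter later? smaller

    private
      reverseAllFin-split : reverse (allFin n) ≡ larger ++ uᵣ ∷ smaller
      reverseAllFin-split =
        split-descending FP._<?_ FP.<-asym descending-reverseAllFin (Any.reverse⁺ (∈-allFin uᵣ))

      atOrLater⇔later : ∀ {c} → c ≢ uᵣ →
        (toℕ r ≤ toℕ (u ⟨$⟩ˡ c) → r F.< u ⟨$⟩ˡ c) × (r F.< u ⟨$⟩ˡ c → toℕ r ≤ toℕ (u ⟨$⟩ˡ c))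
      atOrLater⇔later c≢uᵣ = (λ r≤ → ≤∧≢⇒< r≤ (c≢uᵣ ∘ at-r ∘ FP.toℕ-injective)) , <⇒≤
        where at-r = λ r≡u⁻¹c → trans (sym (inverseʳ u)) (cong (u ⟨$⟩ʳ_) (sym r≡u⁻¹c))

    rowBoxes-larger : rowBoxes u r ≡ filter later? larger
    rowBoxes-larger = filter-×-dec (uᵣ FP.<?_) later? (reverse (allFin n))

    laterValues-suc : laterValues (suc (toℕ r)) ≡ rowBoxes u r ++ smallerLaterValues
    laterValues-suc = begin
      filter later? (reverse (allFin n))
        ≡⟨ cong (filter later?) reverseAllFin-split ⟩
      filter later? (larger ++ uᵣ ∷ smaller)
        ≡⟨ filter-++ later? larger (uᵣ ∷ smaller) ⟩
      filter later? larger ++ filter later? (uᵣ ∷ smaller)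
        ≡⟨ cong₂ _++_ (sym rowBoxes-larger) (filter-reject later? (FP.<-irrefl (sym (inverseˡ u)))) ⟩
      rowBoxes u r ++ smallerLaterValues ∎
      where open ≡-Reasoning

    laterValues-toℕ : laterValues (toℕ r) ≡ rowBoxes u r ++ uᵣ ∷ smallerLaterValues
    laterValues-toℕ = begin
      filter atOrLater? (reverse (allFin n))
        ≡⟨ cong (filter atOrLater?) reverseAllFin-split ⟩
      filter atOrLater? (larger ++ uᵣ ∷ smaller)
        ≡⟨ filter-++ atOrLater? larger (uᵣ ∷ smaller) ⟩
      filter atOrLater? larger ++ filter atOrLater? (uᵣ ∷ smaller)
        ≡⟨ cong (filter atOrLater? larger ++_) (filter-accept atOrLater? (≤-reflexive (cong toℕ (sym (inverseˡ u))))) ⟩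
      filter atOrLater? larger ++ uᵣ ∷ filter atOrLater? smaller
        ≡⟨ cong₂ (λ xs ys → xs ++ uᵣ ∷ ys) (filter-cong-All atOrLater? later? {larger} on-larger)
                                           (filter-cong-All atOrLater? later? {smaller} on-smaller) ⟩
      filter later? larger ++ uᵣ ∷ smallerLaterValues
        ≡⟨ cong (_++ uᵣ ∷ smallerLaterValues) rowBoxes-larger ⟨
      rowBoxes u r ++ uᵣ ∷ smallerLaterValues ∎
      where
        open ≡-Reasoning
        on-larger = All.map (λ uᵣ<c → atOrLater⇔later (λ c≡uᵣ → FP.<-irrefl (sym c≡uᵣ) uᵣ<c))
                            (All.all-filter (uᵣ FP.<?_) (reverse (allFin n)))
        on-smaller = All.map (λ c<uᵣ → atOrLater⇔later (λ c≡uᵣ → FP.<-irrefl c≡uᵣ c<uᵣ))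
                             (All.all-filter (FP._<? uᵣ) (reverse (allFin n)))

    partiallySorted-suc : partiallySorted (suc (toℕ r)) ≡ prefix ++ uᵣ ∷ rowBoxes u r ++ smallerLaterValues
    partiallySorted-suc = begin
      take (suc (toℕ r)) (tabulate (u ⟨$⟩ʳ_)) ++ laterValues (suc (toℕ r))
        ≡⟨ cong₂ _++_ (take-suc-tabulate (u ⟨$⟩ʳ_) r) laterValues-suc ⟩
      (prefix ∷ʳ uᵣ) ++ rowBoxes u r ++ smallerLaterValues
        ≡⟨ ++-assoc prefix [ uᵣ ] _ ⟩
      prefix ++ uᵣ ∷ rowBoxes u r ++ smallerLaterValues ∎
      where open ≡-Reasoning

    rowWord-bubbleWord : rowWord u r ≡ bubbleWord (toℕ r) (length (rowBoxes u r))
    rowWord-bubbleWord = descending-ranks (toℕ r) (AllPairs.filter⁺ (rotheDec u r) descending-reverseAllFin)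

    row-climb : Climb (partiallySorted (suc (toℕ r))) (rowWord u r) (partiallySorted (toℕ r))
    row-climb = Climb-cast (sym partiallySorted-suc) shifted-word (sym (cong (prefix ++_) laterValues-toℕ))
                  (climb-++ˡ prefix (climb-bubble smallerLaterValues above))
      where
        open ≡-Reasoning
        boxes = length (rowBoxes u r)
        above : All (uᵣ F.<_) (rowBoxes u r)
        above = All.map proj₁ (All.all-filter (rotheDec u r) (reverse (allFin n)))
        length-prefix : length prefix ≡ toℕ r
        length-prefix = trans (length-take (toℕ r) _)
          (trans (cong (toℕ r ℕ.⊓_) (length-tabulate _)) (m≤n⇒m⊓n≡m (<⇒≤ (FP.toℕ<n r))))
        shifted-word : map (length prefix +_) (bubbleWord 0 boxes) ≡ rowWord u r
        shifted-word = begin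
          map (length prefix +_) (bubbleWord 0 boxes)  ≡⟨ map-+-bubbleWord (length prefix) 0 boxes ⟩
          bubbleWord (length prefix + 0) boxes         ≡⟨ cong (λ i → bubbleWord i boxes)
                                                               (trans (+-identityʳ _) length-prefix) ⟩
          bubbleWord (toℕ r) boxes                     ≡⟨ rowWord-bubbleWord ⟨
          rowWord u r                                  ∎

  topRowsWord : ℕ → List ℕ
  topRowsWord k = concatMap (rowWord u) (reverse (take k (allFin n)))

  topRowsWord-suc : (r : Fin n) → topRowsWord (suc (toℕ r)) ≡ rowWord u r ++ topRowsWord (toℕ r)
  topRowsWord-suc r = cong (concatMap (rowWord u)) (begin
    reverse (take (suc (toℕ r)) (allFin n))  ≡⟨ cong reverse (take-suc-tabulate id r) ⟩
    reverse (take (toℕ r) (allFin n) ∷ʳ r)   ≡⟨ reverse-++ (take (toℕ r) (allFin n)) [ r ] ⟩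
    r ∷ reverse (take (toℕ r) (allFin n))    ∎)
    where open ≡-Reasoning

  topRows-climb-suc : ∀ {k} (r : Fin n) → toℕ r ≡ k →
                      Climb (partiallySorted k) (topRowsWord k) (partiallySorted 0) →
                      Climb (partiallySorted (suc k)) (topRowsWord (suc k)) (partiallySorted 0)
  topRows-climb-suc r refl c = Climb-cast refl (sym (topRowsWord-suc r)) refl (row-climb r ++ᶜ c)

  topRows-climb : ∀ k → k ≤ n → Climb (partiallySorted k) (topRowsWord k) (partiallySorted 0)
  topRows-climb zero    _   = done
  topRows-climb (suc k) k<n = topRows-climb-suc (fromℕ< k<n) (FP.toℕ-fromℕ< k<n) (topRows-climb k (<⇒≤ k<n))

  partiallySorted-all : partiallySorted n ≡ tabulate (u ⟨$⟩ʳ_)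
  partiallySorted-all = begin
    take n (tabulate (u ⟨$⟩ʳ_)) ++ laterValues n  ≡⟨ cong₂ _++_ (take-all n _ (≤-reflexive (length-tabulate _)))
                                                                 (filter-none _ nothing-later) ⟩
    tabulate (u ⟨$⟩ʳ_) ++ []                      ≡⟨ ++-identityʳ _ ⟩
    tabulate (u ⟨$⟩ʳ_)                            ∎
    where
      open ≡-Reasoning
      nothing-later = All.universal (λ c → <⇒≱ (FP.toℕ<n (u ⟨$⟩ˡ c))) (reverse (allFin n))

  partiallySorted-none : partiallySorted 0 ≡ tabulate opposite
  partiallySorted-none =
    trans (filter-all _ (All.universal (λ _ → z≤n) (reverse (allFin n)))) (reverse-tabulate id)

  topRowsWord-all : topRowsWord n ≡ rotheWord u
  topRowsWord-all =
    cong (concatMap (rowWord u) ∘ reverse) (take-all n (allFin n) (≤-reflexive (length-tabulate id)))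

  rotheWord-climb : Climb (tabulate (u ⟨$⟩ʳ_)) (rotheWord u) (tabulate opposite)
  rotheWord-climb = Climb-cast partiallySorted-all topRowsWord-all partiallySorted-none (topRows-climb n ≤-refl)

lemma3p12 : (n : ℕ) (u : Permutation′ n)
    → (∀ (j : Fin n) → u ⟨$⟩ʳ (wordFn (rotheWord u) j) ≡ w₀ j)
    × Reduced n (rotheWord u)
lemma3p12 n u = factorisation , validLetters , shortest
  where
    open Inversions (FP._<?_ {n} {n}) FP.<-asym
    open Rothe u using (rotheWord-climb)
    open ≡-Reasoning
    U = u ⟨$⟩ʳ_
    action : ∀ w → tabulate (U ∘ wordFn w) ≡ applyWord (tabulate U) w
    action w = tabulate-∘-wordFn w U
    factorisation : U ∘ wordFn (rotheWord u) ≗ w₀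
    factorisation = tabulate-injective (trans (action (rotheWord u)) (climb-applyWord rotheWord-climb))
    validLetters : All (ValidLetter n) (rotheWord u)
    validLetters = subst (λ m → All (ValidLetter m) (rotheWord u)) (length-tabulate U)
                         (climb-validLetters rotheWord-climb)
    shortest : ∀ w′ → All (ValidLetter n) w′ → wordFn w′ ≗ wordFn (rotheWord u) →
               length (rotheWord u) ≤ length w′
    shortest w′ _ same = climb-shortest w′ rotheWord-climb (begin
      applyWord (tabulate U) w′  ≡⟨ action w′ ⟨
      tabulate (U ∘ wordFn w′)   ≡⟨ tabulate-cong (λ j → trans (cong U (same j)) (factorisation j)) ⟩
      tabulate w₀                ∎)
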